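{- Let $m\geq 1$ and $s\geq 1$ be integers. Among all partitions that are simultaneously $s$-cores, $(ms-1)$-cores and $(ms+1)$-cores, consider the one with the largest number of parts (the longest one). Its weight (the sum of its parts) equals \begin{enumerate} \item $\dfrac{m^2t(t-1)(t^2-t+1)}{6}$ if $s=2t-1$, and \item $\dfrac{m^2(t-1)^2(t^2-2t+3)}{6}-\dfrac{m(t-1)^2}{2}$ if $s=2t-2$. \end{enumerate}
   Context: For a box of the Young diagram of a partition, its hook length is the number of boxes in the same row weakly to its right plus the number of boxes in the same column strictly below it. A partition is an $a$-core if none of its hook lengths equals $a$; an $(a,b,c)$-core is a partition that is simultaneously an $a$-core, a $b$-core and a $c$-core. The number of parts of a partition is its length. -}

module Defs where

open import Data.Nat using (ℕ; zero; suc; _+_; _*_; _∸_; _<_; _≤_; _≥_)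
open import Data.List using (List; []; _∷_; length; filter)
open import Data.Nat.ListAction using (sum)
open import Data.List.Relation.Unary.All using (All)
open import Data.List.Relation.Unary.Linked using (Linked)
open import Data.Nat using (_<?_)
open import Data.Product using (_×_)
open import Relation.Binary.PropositionalEquality using (_≢_)

IsPartition : List ℕ → Set
IsPartition λs = Linked _≥_ λs × All (λ x → 0 < x) λs

record Partition : Set where
  constructor mkPartition
  field
    parts     : List ℕ
    isPartition : IsPartition parts
open Partition public

-- i-th part (0-indexed); 0 beyond the length.
part : List ℕ → ℕ → ℕ
part []       _       = 0
part (x ∷ xs) zero    = x
part (x ∷ xs) (suc i) = part xs i

conjPart : List ℕ → ℕ → ℕ
conjPart λs j = length (filter (λ x → j <? x) λs)

len : Partition → ℕ
len p = length (parts p)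

weight : Partition → ℕ
weight p = sum (parts p)

-- (i , j) is a box of the Young diagram (0-indexed row i, column j)
IsBox : Partition → ℕ → ℕ → Set
IsBox p i j = (i < len p) × (j < part (parts p) i)

-- hook length of box (i , j): boxes weakly right in row i
-- plus boxes strictly below in column j
hook : Partition → ℕ → ℕ → ℕ
hook p i j = (part (parts p) i ∸ j) + (conjPart (parts p) j ∸ suc i)

IsCore : ℕ → Partition → Set
IsCore a p = ∀ i j → IsBox p i j → hook p i j ≢ a

Is3Core : ℕ → ℕ → ℕ → Partition → Set
Is3Core a b c p = IsCore a p × IsCore b p × IsCore c p

IsLongest3Core : ℕ → ℕ → ℕ → Partition → Set
IsLongest3Core a b c p = Is3Core a b c p × (∀ q → Is3Core a b c q → len q ≤ len p)

module Submission where

-- A partition is encoded by its β-set (first-column hook lengths); it is a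
-- g-core exactly when its β-set is closed under removing g.  A partition
-- that is an s-, B- and A-core (B = ms - 1, A = ms + 1) therefore has a
-- β-set of positive numbers avoiding the numerical semigroup ⟨s, B, A⟩, i.e.
-- contained in its set of gaps.  Conversely the gap set is itself closed
-- under removing generators, so the partition with β-set = gaps is the
-- unique longest (s, B, A)-core.  Writing n = r + q·s, n is a gap exactly
-- when q < gapCount r, where gapCount r = r·m if 2r < s and (s - r)·m - 1
-- otherwise.  The weight follows from 2·|λ| + ℓ² = 2·Σ gaps + ℓ, summing
-- residue class by residue class: every class contributes a quadratic in
-- its index, so the sums are evaluated by ∑ j and ∑ j² and a final ring
-- identity in each of the cases s = 2t - 1 and s = 2t - 2.

open import Defs
open import Data.Nat using (ℕ; _+_; _*_; _∸_; _≤_)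
open import Data.Product using (_×_; ∃)
open import Relation.Binary.PropositionalEquality using (_≡_)
open import Data.Nat
open import Data.Nat.Properties
open import Data.Nat.DivMod using (_%_; _/_; m≡m%n+[m/n]*n; m%n<n; [m+kn]%n≡m%n; m<n⇒m%n≡m)
open import Data.Nat.ListAction using (sum)
open import Data.Nat.Tactic.RingSolver using (solve-∀)
open import Data.List using (List; []; _∷_; length; map)
open import Data.List.Properties using (filter-accept; filter-reject; length-filter)
open import Data.List.Relation.Unary.All using (All; []; _∷_)
import Data.List.Relation.Unary.All as All
open import Data.List.Relation.Unary.Linked using (Linked; []; [-]; _∷_)
import Data.List.Relation.Unary.Linked as Linked
open import Data.List.Relation.Unary.Linked.Properties using (Linked⇒All)
open import Data.List.Membership.Propositional using (_∈_; _∉_)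
open import Data.List.Relation.Unary.Any using (here; there)
open import Data.Product using (Σ; _,_; proj₁; proj₂)
open import Data.Sum using (_⊎_; inj₁; inj₂)
open import Data.Empty using (⊥; ⊥-elim)
open import Relation.Nullary using (¬_; Dec; yes; no)
open import Relation.Binary using (tri<; tri≈; tri>)
open import Relation.Binary.PropositionalEquality
  using (_≢_; refl; sym; trans; cong; cong₂; subst; module ≡-Reasoning)

Decreasing : List ℕ → Set
Decreasing = Linked _≥_

StrictlyDecreasing : List ℕ → Set
StrictlyDecreasing = Linked _>_

decreasing-head : ∀ {x xs} → Decreasing (x ∷ xs) → All (_≤ x) xs
decreasing-head [-] = []
decreasing-head (r ∷ l) = Linked⇒All (λ a b → ≤-trans b a) r l

strict-head : ∀ {x xs} → StrictlyDecreasing (x ∷ xs) → All (_< x) xs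
strict-head [-] = []
strict-head (r ∷ l) = Linked⇒All (λ a b → <-trans b a) r l

strict-length< : ∀ b bs → StrictlyDecreasing (b ∷ bs) → All (0 <_) (b ∷ bs) → length bs < b
strict-length< b [] _ (p ∷ _) = p
strict-length< b (b' ∷ bs) (r ∷ l) (_ ∷ ps) = <-≤-trans (s≤s (strict-length< b' bs l ps)) r

strict-⊆ : ∀ xs ys → StrictlyDecreasing xs → StrictlyDecreasing ys →
           (∀ {z} → z ∈ xs → z ∈ ys) →
           length xs ≤ length ys × (length ys ≤ length xs → xs ≡ ys)
strict-⊆ [] [] _ _ _ = z≤n , λ _ → refl
strict-⊆ [] (y ∷ ys) _ _ _ = z≤n , λ ()
strict-⊆ (x ∷ xs) [] _ _ inc with inc (here refl)
... | ()
strict-⊆ (x ∷ xs) (y ∷ ys) sx sy inc with <-cmp x y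
... | tri≈ _ refl _ =
  let (le , eq) = strict-⊆ xs ys (Linked.tail sx) (Linked.tail sy) inc-tail
  in s≤s le , λ { (s≤s ge) → cong (x ∷_) (eq ge) }
  where
  inc-tail : ∀ {z} → z ∈ xs → z ∈ ys
  inc-tail m with inc (there m)
  ... | here refl = ⊥-elim (<-irrefl refl (All.lookup (strict-head sx) m))
  ... | there m' = m'
... | tri< x<y _ _ =
  let (le , _) = strict-⊆ (x ∷ xs) ys sx (Linked.tail sy) inc-tail
  in m≤n⇒m≤1+n le , λ ge → ⊥-elim (<⇒≱ (s≤s le) ge)
  where
  inc-tail : ∀ {z} → z ∈ x ∷ xs → z ∈ ys
  inc-tail m with inc m
  ... | there m' = m'
  inc-tail (here refl) | here refl = ⊥-elim (<-irrefl refl x<y)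
  inc-tail (there m) | here refl = ⊥-elim (<-asym (All.lookup (strict-head sx) m) x<y)
... | tri> _ _ y<x with inc (here refl)
...   | here eq = ⊥-elim (<-irrefl (sym eq) y<x)
...   | there m = ⊥-elim (<-asym y<x (All.lookup (strict-head sy) m))

-- The β-set of a partition λ₀ ≥ … ≥ λₙ₋₁: its first-column hook lengths
-- λᵢ + (n - 1 - i).  It is strictly decreasing and determines the partition.
betaSet : List ℕ → List ℕ
betaSet [] = []
betaSet (x ∷ xs) = x + length xs ∷ betaSet xs

fromBetaSet : List ℕ → List ℕ
fromBetaSet [] = []
fromBetaSet (b ∷ bs) = b ∸ length bs ∷ fromBetaSet bs

length-betaSet : ∀ xs → length (betaSet xs) ≡ length xs
length-betaSet [] = refl
length-betaSet (x ∷ xs) = cong suc (length-betaSet xs)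

length-fromBetaSet : ∀ bs → length (fromBetaSet bs) ≡ length bs
length-fromBetaSet [] = refl
length-fromBetaSet (b ∷ bs) = cong suc (length-fromBetaSet bs)

fromBetaSet-betaSet : ∀ xs → fromBetaSet (betaSet xs) ≡ xs
fromBetaSet-betaSet [] = refl
fromBetaSet-betaSet (x ∷ xs) rewrite length-betaSet xs | m+n∸n≡m x (length xs) =
  cong (x ∷_) (fromBetaSet-betaSet xs)

betaSet-fromBetaSet : ∀ bs → StrictlyDecreasing bs → All (0 <_) bs → betaSet (fromBetaSet bs) ≡ bs
betaSet-fromBetaSet [] _ _ = refl
betaSet-fromBetaSet (b ∷ bs) sd ps rewrite length-fromBetaSet bs =
  cong₂ _∷_ (m∸n+n≡m (<⇒≤ (strict-length< b bs sd ps)))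
            (betaSet-fromBetaSet bs (Linked.tail sd) (All.tail ps))

fromBetaSet-decreasing : ∀ bs → StrictlyDecreasing bs → All (0 <_) bs → Decreasing (fromBetaSet bs)
fromBetaSet-decreasing [] _ _ = []
fromBetaSet-decreasing (b ∷ []) _ _ = [-]
fromBetaSet-decreasing (b ∷ b' ∷ bs) (r ∷ l) (_ ∷ ps) =
  ∸-monoˡ-≤ (suc (length bs)) r ∷ fromBetaSet-decreasing (b' ∷ bs) l ps

fromBetaSet-positive : ∀ bs → StrictlyDecreasing bs → All (0 <_) bs → All (0 <_) (fromBetaSet bs)
fromBetaSet-positive [] _ _ = []
fromBetaSet-positive (b ∷ bs) sd ps =
  m<n⇒0<n∸m (strict-length< b bs sd ps) ∷ fromBetaSet-positive bs (Linked.tail sd) (All.tail ps)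

betaSet-strict : ∀ xs → Decreasing xs → StrictlyDecreasing (betaSet xs)
betaSet-strict [] _ = []
betaSet-strict (x ∷ []) _ = [-]
betaSet-strict (x ∷ y ∷ ys) (x≥y ∷ d) = +-mono-≤-< x≥y (n<1+n _) ∷ betaSet-strict (y ∷ ys) d

betaSet-positive : ∀ xs → All (0 <_) xs → All (0 <_) (betaSet xs)
betaSet-positive [] _ = []
betaSet-positive (x ∷ xs) (p ∷ ps) = ≤-trans p (m≤m+n _ _) ∷ betaSet-positive xs ps

betaSet-sum : ∀ xs → sum (betaSet xs) * 2 + length xs ≡ sum xs * 2 + length xs * length xs
betaSet-sum [] = refl
betaSet-sum (x ∷ xs) = begin
  (x + n + sum (betaSet xs)) * 2 + suc n      ≡⟨ expand x n (sum (betaSet xs)) ⟩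
  x * 2 + n * 2 + 1 + (sum (betaSet xs) * 2 + n) ≡⟨ cong (x * 2 + n * 2 + 1 +_) (betaSet-sum xs) ⟩
  x * 2 + n * 2 + 1 + (sum xs * 2 + n * n)    ≡⟨ collect x n (sum xs) ⟩
  (x + sum xs) * 2 + suc n * suc n            ∎
  where
  open ≡-Reasoning
  n = length xs
  expand : ∀ x n b → (x + n + b) * 2 + suc n ≡ x * 2 + n * 2 + 1 + (b * 2 + n)
  expand = solve-∀
  collect : ∀ x n w → x * 2 + n * 2 + 1 + (w * 2 + n * n) ≡ (x + w) * 2 + suc n * suc n
  collect = solve-∀

betaSet-sum-inverse : ∀ bs → StrictlyDecreasing bs → All (0 <_) bs →
                      sum bs * 2 + length bs ≡ sum (fromBetaSet bs) * 2 + length bs * length bs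
betaSet-sum-inverse bs sd pos = begin
  sum bs * 2 + length bs                  ≡⟨ cong₂ (λ b n → sum b * 2 + n) (sym β-inv) (sym len-inv) ⟩
  sum (betaSet xs) * 2 + length xs        ≡⟨ betaSet-sum xs ⟩
  sum xs * 2 + length xs * length xs      ≡⟨ cong (λ n → sum xs * 2 + n * n) len-inv ⟩
  sum xs * 2 + length bs * length bs      ∎
  where
  open ≡-Reasoning
  xs = fromBetaSet bs
  β-inv = betaSet-fromBetaSet bs sd pos
  len-inv = length-fromBetaSet bs
conjPart-< : ∀ {x j} xs → j < x → conjPart (x ∷ xs) j ≡ suc (conjPart xs j)
conjPart-< {x} {j} xs j<x = cong length (filter-accept (λ y → j <? y) j<x)

conjPart-≥ : ∀ {x j} xs → x ≤ j → conjPart (x ∷ xs) j ≡ conjPart xs j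
conjPart-≥ {x} {j} xs x≤j = cong length (filter-reject (λ y → j <? y) (λ j<x → <⇒≱ j<x x≤j))

conjPart-≤-length : ∀ xs j → conjPart xs j ≤ length xs
conjPart-≤-length xs j = length-filter (λ y → j <? y) xs

conjPart-beyond : ∀ {j} xs → All (_≤ j) xs → conjPart xs j ≡ 0
conjPart-beyond [] [] = refl
conjPart-beyond (x ∷ xs) (p ∷ ps) = trans (conjPart-≥ xs p) (conjPart-beyond xs ps)

-- nonBeta xs j, for j below the largest part x of a partition x ∷ xs, runs
-- through the numbers below the top β-number x + length xs that are not
-- β-numbers of xs; the hook of the box (0 , j) is their difference.
nonBeta : List ℕ → ℕ → ℕ
nonBeta xs j = j + (length xs ∸ conjPart xs j)

nonBeta-< : ∀ {y j} ys → j < y → nonBeta (y ∷ ys) j ≡ nonBeta ys j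
nonBeta-< ys j<y rewrite conjPart-< ys j<y = refl

nonBeta-≥ : ∀ {y j} ys → y ≤ j → nonBeta (y ∷ ys) j ≡ suc (nonBeta ys j)
nonBeta-≥ {y} {j} ys y≤j rewrite conjPart-≥ ys y≤j
  | +-∸-assoc 1 (conjPart-≤-length ys j) = +-suc j _

nonBeta-≤ : ∀ xs j → nonBeta xs j ≤ j + length xs
nonBeta-≤ xs j = +-monoʳ-≤ j (m∸n≤m (length xs) (conjPart xs j))

betaSet-< : ∀ {y} ys → Decreasing ys → All (_≤ y) ys → All (_< y + length ys) (betaSet ys)
betaSet-< [] _ _ = []
betaSet-< {y} (z ∷ zs) d (z≤y ∷ _) =
  +-mono-≤-< z≤y (n<1+n _) ∷
  All.map (λ w< → <-≤-trans w< (+-mono-≤ z≤y (n≤1+n _)))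
          (betaSet-< zs (Linked.tail d) (decreasing-head d))

below-top : ∀ x xs → Decreasing xs → All (_≤ x) xs → ∀ v → v < x + length xs →
            v ∈ betaSet xs ⊎ Σ ℕ (λ j → j < x × nonBeta xs j ≡ v)
below-top x [] _ _ v v< = inj₂ (v , subst (v <_) (+-identityʳ x) v< , +-identityʳ v)
below-top x (y ∷ ys) d (y≤x ∷ a) v v< with <-cmp v (y + length ys)
... | tri≈ _ refl _ = inj₁ (here refl)
... | tri< v<y _ _ with below-top y ys (Linked.tail d) (decreasing-head d) v v<y
...   | inj₁ m = inj₁ (there m)
...   | inj₂ (j , j<y , eq) = inj₂ (j , <-≤-trans j<y y≤x , trans (nonBeta-< ys j<y) eq)
below-top x (y ∷ ys) d (y≤x ∷ a) zero v< | tri> _ _ ()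
below-top x (y ∷ ys) d (y≤x ∷ a) (suc v) v< | tri> _ _ (s≤s top<v)
  with below-top x ys (Linked.tail d) a v (≤-pred (subst (suc v <_) (+-suc x (length ys)) v<))
... | inj₁ m = ⊥-elim (<⇒≱ (All.lookup (betaSet-< ys (Linked.tail d) (decreasing-head d)) m) top<v)
... | inj₂ (j , j<x , eq) with j <? y
...   | yes j<y = ⊥-elim (<⇒≱ (≤-<-trans (nonBeta-≤ ys j) (+-monoˡ-< (length ys) j<y))
                                (subst (y + length ys ≤_) (sym eq) top<v))
...   | no j≮y = inj₂ (j , j<x , trans (nonBeta-≥ ys (≮⇒≥ j≮y)) (cong suc eq))

nonBeta-∉ : ∀ x xs → Decreasing xs → All (_≤ x) xs → ∀ j → j < x → nonBeta xs j ∉ betaSet xs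
nonBeta-∉ x [] _ _ j _ ()
nonBeta-∉ x (y ∷ ys) d _ j j<x m with j <? y
... | yes j<y = not-in (subst (_∈ betaSet (y ∷ ys)) (nonBeta-< ys j<y) m)
  where
  not-in : nonBeta ys j ∈ betaSet (y ∷ ys) → ⊥
  not-in (here eq) = <⇒≢ (≤-<-trans (nonBeta-≤ ys j) (+-monoˡ-< (length ys) j<y)) eq
  not-in (there m') = nonBeta-∉ y ys (Linked.tail d) (decreasing-head d) j j<y m'
... | no j≮y = <⇒≱ (s≤s (+-monoˡ-≤ (length ys) y≤j)) (subst (_≤ y + length ys) above (beta≤top m))
  where
  y≤j = ≮⇒≥ j≮y
  beta≤top : ∀ {b} → b ∈ betaSet (y ∷ ys) → b ≤ y + length ys
  beta≤top (here refl) = ≤-refl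
  beta≤top (there m') = <⇒≤ (All.lookup (betaSet-< ys (Linked.tail d) (decreasing-head d)) m')
  above : nonBeta (y ∷ ys) j ≡ suc (j + length ys)
  above = trans (nonBeta-≥ ys y≤j)
            (cong (λ c → suc (j + (length ys ∸ c)))
              (conjPart-beyond ys (All.map (λ p → ≤-trans p y≤j) (decreasing-head d))))

-- Hook lengths and cores, read off the list of parts (definitionally the
-- notions of Defs for a partition p).
hookL : List ℕ → ℕ → ℕ → ℕ
hookL xs i j = (part xs i ∸ j) + (conjPart xs j ∸ suc i)

ListCore : ℕ → List ℕ → Set
ListCore g xs = ∀ i j → (i < length xs) × (j < part xs i) → hookL xs i j ≢ g

first-row-hook : ∀ {x j} xs → j < x → hookL (x ∷ xs) 0 j + nonBeta xs j ≡ x + length xs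
first-row-hook {x} {j} xs j<x rewrite conjPart-< xs j<x =
  trans (regroup (x ∸ j) (conjPart xs j) j (length xs ∸ conjPart xs j))
        (cong₂ _+_ (m∸n+n≡m (<⇒≤ j<x)) (m+[n∸m]≡n (conjPart-≤-length xs j)))
  where
  regroup : ∀ a b c d → a + b + (c + d) ≡ (a + c) + (b + d)
  regroup = solve-∀

part-≤ : ∀ {x} xs → All (_≤ x) xs → ∀ i → part xs i ≤ x
part-≤ [] _ i = z≤n
part-≤ (y ∷ ys) (p ∷ _) zero = p
part-≤ (y ∷ ys) (_ ∷ ps) (suc i) = part-≤ ys ps i

hook-tail : ∀ {x} xs → Decreasing (x ∷ xs) → ∀ i j → j < part xs i →
            hookL (x ∷ xs) (suc i) j ≡ hookL xs i j
hook-tail {x} xs d i j j< rewrite conjPart-< {x} xs (<-≤-trans j< (part-≤ xs (decreasing-head d) i)) = refl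

core-tail : ∀ {g x} xs → Decreasing (x ∷ xs) → ListCore g (x ∷ xs) → ListCore g xs
core-tail xs d c i j (i< , j<) eq = c (suc i) j (s≤s i< , j<) (trans (hook-tail xs d i j j<) eq)

Closed : ℕ → List ℕ → Set
Closed g bs = ∀ {b} → b ∈ bs → g ≤ b → b ∸ g ∈ bs

closed-tail : ∀ {g b} bs → StrictlyDecreasing (b ∷ bs) → Closed g (b ∷ bs) → Closed g bs
closed-tail {g} bs sd cl {b'} m g≤b' with cl (there m) g≤b'
... | here eq = ⊥-elim (<-irrefl eq (≤-<-trans (m∸n≤m b' g) (All.lookup (strict-head sd) m)))
... | there m' = m'

core⇒closed : ∀ {g} xs → Decreasing xs → ListCore g xs → Closed g (betaSet xs)
core⇒closed {zero} xs _ _ m _ = m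
core⇒closed {suc g} (x ∷ xs) d c (here refl) g≤ = there top-step
  where
  top-step : (x + length xs) ∸ suc g ∈ betaSet xs
  top-step with below-top x xs (Linked.tail d) (decreasing-head d) ((x + length xs) ∸ suc g)
                  (∸-monoʳ-< (s≤s z≤n) g≤)
  ... | inj₁ m = m
  ... | inj₂ (j , j<x , eq) = ⊥-elim (c 0 j (s≤s z≤n , j<x) hook≡g)
    where
    hook≡g : hookL (x ∷ xs) 0 j ≡ suc g
    hook≡g = trans (sym (m+n∸n≡m _ (nonBeta xs j)))
               (trans (cong₂ _∸_ (first-row-hook xs j<x) eq) (m∸[m∸n]≡n g≤))
core⇒closed {suc g} (x ∷ xs) d c (there m) g≤ =
  there (core⇒closed xs (Linked.tail d) (core-tail xs d c) m g≤)

closed⇒core : ∀ {g} xs → Decreasing xs → Closed g (betaSet xs) → ListCore g xs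
closed⇒core [] _ _ i j (() , _) eq
closed⇒core {g} (x ∷ xs) d cl zero j (_ , j<x) eq =
  nonBeta-∉ x xs (Linked.tail d) (decreasing-head d) j j<x
    (subst (_∈ betaSet xs) top∸g≡nonBeta top∸g∈tail)
  where
  hook+nonBeta = first-row-hook xs j<x
  1≤g : 1 ≤ g
  1≤g = subst (1 ≤_) eq (≤-trans (m<n⇒0<n∸m j<x) (m≤m+n _ _))
  g≤top : g ≤ x + length xs
  g≤top = subst (_≤ x + length xs) eq (subst (hookL (x ∷ xs) 0 j ≤_) hook+nonBeta (m≤m+n _ _))
  top∸g∈tail : (x + length xs) ∸ g ∈ betaSet xs
  top∸g∈tail with cl (here refl) g≤top
  ... | here e = ⊥-elim (<-irrefl e (∸-monoʳ-< 1≤g g≤top))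
  ... | there m = m
  top∸g≡nonBeta : (x + length xs) ∸ g ≡ nonBeta xs j
  top∸g≡nonBeta = trans (cong (_∸ g) (sym hook+nonBeta))
                    (trans (cong (λ h → h + nonBeta xs j ∸ g) eq) (m+n∸m≡n g _))
closed⇒core (x ∷ xs) d cl (suc i) j (s≤s i< , j<) eq =
  closed⇒core xs (Linked.tail d) (closed-tail (betaSet xs) (betaSet-strict (x ∷ xs) d) cl)
    i j (i< , j<) (trans (sym (hook-tail xs d i j j<)) eq)

sumBelow : ℕ → (ℕ → ℕ) → ℕ
sumBelow zero f = 0
sumBelow (suc n) f = sumBelow n f + f n

syntax sumBelow n (λ i → e) = ∑[ i < n ] e

sum-cong : ∀ n {f g} → (∀ i → i < n → f i ≡ g i) → sumBelow n f ≡ sumBelow n g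
sum-cong zero eq = refl
sum-cong (suc n) eq = cong₂ _+_ (sum-cong n (λ i i<n → eq i (m≤n⇒m≤1+n i<n))) (eq n ≤-refl)

sum-zero : ∀ n f → (∀ i → i < n → f i ≡ 0) → sumBelow n f ≡ 0
sum-zero n f vanish = trans (sum-cong n vanish) (zeros n)
  where
  zeros : ∀ n → ∑[ i < n ] 0 ≡ 0
  zeros zero = refl
  zeros (suc n) = cong (_+ 0) (zeros n)

sum-+ : ∀ n f g → ∑[ i < n ] (f i + g i) ≡ sumBelow n f + sumBelow n g
sum-+ zero f g = refl
sum-+ (suc n) f g rewrite sum-+ n f g = swap-middle (sumBelow n f) (sumBelow n g) (f n) (g n)
  where
  swap-middle : ∀ a b c d → a + b + (c + d) ≡ a + c + (b + d)
  swap-middle = solve-∀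

sum-split : ∀ a b f → sumBelow (a + b) f ≡ sumBelow a f + ∑[ i < b ] f (a + i)
sum-split a zero f rewrite +-identityʳ a = sym (+-identityʳ _)
sum-split a (suc b) f rewrite +-suc a b =
  trans (cong (_+ f (a + b)) (sum-split a b f)) (+-assoc (sumBelow a f) _ (f (a + b)))

sum-reverse : ∀ n f → sumBelow n f ≡ ∑[ i < n ] f (n ∸ suc i)
sum-reverse zero f = refl
sum-reverse (suc n) f = trans (cong (_+ f n) (sum-reverse n f))
  (trans (+-comm _ (f n)) (sym (sum-split 1 n (λ i → f (n ∸ i)))))

sum-swap : ∀ a b (F : ℕ → ℕ → ℕ) → ∑[ i < a ] ∑[ j < b ] F i j ≡ ∑[ j < b ] ∑[ i < a ] F i j
sum-swap zero b F = sym (sum-zero b (λ _ → 0) (λ _ _ → refl))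
sum-swap (suc a) b F = trans (cong (_+ ∑[ j < b ] F a j) (sum-swap a b F))
  (sym (sum-+ b (λ j → ∑[ i < a ] F i j) (λ j → F a j)))

sum-blocks : ∀ K s F → sumBelow (K * s) F ≡ ∑[ q < K ] ∑[ r < s ] F (r + q * s)
sum-blocks zero s F = refl
sum-blocks (suc K) s F = begin
  sumBelow (s + K * s) F                         ≡⟨ cong (λ z → sumBelow z F) (+-comm s (K * s)) ⟩
  sumBelow (K * s + s) F                         ≡⟨ sum-split (K * s) s F ⟩
  sumBelow (K * s) F + ∑[ r < s ] F (K * s + r)  ≡⟨ cong₂ _+_ (sum-blocks K s F)
                                                     (sum-cong s (λ r _ → cong F (+-comm (K * s) r))) ⟩
  ∑[ q < K ] ∑[ r < s ] F (r + q * s) + ∑[ r < s ] F (r + K * s) ∎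
  where open ≡-Reasoning

sum-truncate : ∀ K c F G → c ≤ K → (∀ q → q < c → G q ≡ F q) → (∀ q → c ≤ q → q < K → G q ≡ 0) →
               sumBelow K G ≡ sumBelow c F
sum-truncate K c F G c≤K agree vanish = begin
  sumBelow K G                                ≡⟨ cong (λ z → sumBelow z G) (sym (m+[n∸m]≡n c≤K)) ⟩
  sumBelow (c + (K ∸ c)) G                    ≡⟨ sum-split c (K ∸ c) G ⟩
  sumBelow c G + ∑[ i < K ∸ c ] G (c + i)     ≡⟨ cong₂ _+_ (sum-cong c agree) (sum-zero (K ∸ c) _ tail-vanishes) ⟩
  sumBelow c F + 0                            ≡⟨ +-identityʳ _ ⟩
  sumBelow c F                                ∎
  where
  open ≡-Reasoning
  tail-vanishes : ∀ i → i < K ∸ c → G (c + i) ≡ 0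
  tail-vanishes i i< = vanish (c + i) (m≤m+n c i) (subst (c + i <_) (m+[n∸m]≡n c≤K) (+-monoʳ-< c i<))

sum-arithmetic : ∀ r d c → ∑[ q < c ] (2 * (r + q * d) + 1) + d * c ≡ c * (2 * r + 1 + d * c)
sum-arithmetic r d zero = *-zeroʳ d
sum-arithmetic r d (suc c) = +-cancelʳ-≡ (d * c) _ _ (begin
  S + (2 * (r + c * d) + 1) + d * suc c + d * c ≡⟨ regroup S r c d ⟩
  (S + d * c) + (2 * (r + c * d) + 1) + d * suc c ≡⟨ cong (λ z → z + (2 * (r + c * d) + 1) + d * suc c) (sum-arithmetic r d c) ⟩
  c * (2 * r + 1 + d * c) + (2 * (r + c * d) + 1) + d * suc c ≡⟨ step r c d ⟩
  suc c * (2 * r + 1 + d * suc c) + d * c ∎)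
  where
  open ≡-Reasoning
  S = ∑[ q < c ] (2 * (r + q * d) + 1)
  regroup : ∀ S r c d → S + (2 * (r + c * d) + 1) + d * suc c + d * c ≡ (S + d * c) + (2 * (r + c * d) + 1) + d * suc c
  regroup = solve-∀
  step : ∀ r c d → c * (2 * r + 1 + d * c) + (2 * (r + c * d) + 1) + d * suc c ≡ suc c * (2 * r + 1 + d * suc c) + d * c
  step = solve-∀

-- Six times the sum of the quadratic a·j² + b·j + c over j = 1, …, n.
sixSumQuadratic : ℕ → ℕ → ℕ → ℕ → ℕ
sixSumQuadratic a b c n = a * (n * suc n * suc (2 * n)) + 3 * b * (n * suc n) + 6 * c * n

sum-quadratic : ∀ (f : ℕ → ℕ) a b c a' b' c' n →
  (∀ i → i < n → f i + (a * (suc i * suc i) + b * suc i + c) ≡ a' * (suc i * suc i) + b' * suc i + c') →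
  6 * sumBelow n f + sixSumQuadratic a b c n ≡ sixSumQuadratic a' b' c' n
sum-quadratic f a b c a' b' c' zero _ = empty a b c a' b' c'
  where
  empty : ∀ a b c a' b' c' → 6 * 0 + (a * 0 + 3 * b * 0 + 6 * c * 0) ≡ a' * 0 + 3 * b' * 0 + 6 * c' * 0
  empty = solve-∀
sum-quadratic f a b c a' b' c' (suc n) term = begin
  6 * (S + f n) + sixSumQuadratic a b c (suc n)                         ≡⟨ cong (6 * (S + f n) +_) (next a b c n) ⟩
  6 * (S + f n) + (sixSumQuadratic a b c n + 6 * (a * (suc n * suc n) + b * suc n + c))
      ≡⟨ regroup S (f n) (sixSumQuadratic a b c n) a b c n ⟩
  (6 * S + sixSumQuadratic a b c n) + 6 * (f n + (a * (suc n * suc n) + b * suc n + c))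
      ≡⟨ cong₂ (λ x y → x + 6 * y) (sum-quadratic f a b c a' b' c' n (λ i i<n → term i (m≤n⇒m≤1+n i<n))) (term n ≤-refl) ⟩
  sixSumQuadratic a' b' c' n + 6 * (a' * (suc n * suc n) + b' * suc n + c') ≡⟨ sym (next a' b' c' n) ⟩
  sixSumQuadratic a' b' c' (suc n)                                      ∎
  where
  open ≡-Reasoning
  S = sumBelow n f
  next : ∀ a b c n → a * (suc n * suc (suc n) * suc (2 * suc n)) + 3 * b * (suc n * suc (suc n)) + 6 * c * suc n
         ≡ (a * (n * suc n * suc (2 * n)) + 3 * b * (n * suc n) + 6 * c * n) + 6 * (a * (suc n * suc n) + b * suc n + c)
  next = solve-∀
  regroup : ∀ S F Q a b c n → 6 * (S + F) + (Q + 6 * (a * (suc n * suc n) + b * suc n + c))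
            ≡ (6 * S + Q) + 6 * (F + (a * (suc n * suc n) + b * suc n + c))
  regroup = solve-∀

sum-ones : ∀ n → ∑[ i < n ] 1 ≡ n
sum-ones zero = refl
sum-ones (suc n) = trans (cong (_+ 1) (sum-ones n)) (+-comm n 1)

length-as-sum : ∀ {A : Set} (xs : List A) → sum (map (λ _ → 1) xs) ≡ length xs
length-as-sum [] = refl
length-as-sum (x ∷ xs) = cong suc (length-as-sum xs)

sum-map-odd : ∀ xs → sum (map (λ b → 2 * b + 1) xs) ≡ sum xs * 2 + length xs
sum-map-odd [] = refl
sum-map-odd (x ∷ xs) = trans (cong (2 * x + 1 +_) (sum-map-odd xs)) (step x (sum xs) (length xs))
  where
  step : ∀ x S n → 2 * x + 1 + (S * 2 + n) ≡ (x + S) * 2 + suc n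
  step = solve-∀

-- Ring identities used to rewrite elements of ⟨s, ms - 1, ms + 1⟩ with
-- m = m' + 1 and s = s' + 1, where ms - 1 is definitionally s' + m'·s.
add-s : ∀ a k s → a + k * s + s ≡ a + suc k * s
add-s = solve-∀

add-generator : ∀ g x k s → x * g + k * s + g ≡ suc x * g + k * s
add-generator = solve-∀

A-cancels-B : ∀ m' s' x k → suc x * (s' + m' * suc s') + k * suc s' + (suc m' * suc s' + 1)
              ≡ x * (s' + m' * suc s') + (k + 2 * suc m') * suc s'
A-cancels-B = solve-∀

B-cancels-A : ∀ m' s' x k → suc x * (suc m' * suc s' + 1) + k * suc s' + (s' + m' * suc s')
              ≡ x * (suc m' * suc s' + 1) + (k + 2 * suc m') * suc s'
B-cancels-A = solve-∀

A-form : ∀ m' s' x k → x * (suc m' * suc s' + 1) + k * suc s' ≡ x + (x * suc m' + k) * suc s'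
A-form = solve-∀

B-form : ∀ m' v r d → suc v * (r + v + m' * suc (r + v)) + d * suc (r + v)
         ≡ r + ((m' + v * suc m') + d) * suc (r + v)
B-form = solve-∀

merge-multiples : ∀ s a b ρ σ → ρ + σ * s + (a + b) * s ≡ ρ + (σ + a + b) * s
merge-multiples = solve-∀

distribute : ∀ m s ρ σ → (ρ + σ * s) * m ≡ ρ * m + σ * (s * m)
distribute = solve-∀

interleave : ∀ s r k ρ σ → r + k * s + (ρ + σ * s) ≡ (r + ρ) + (k + σ) * s
interleave = solve-∀

B-multiple : ∀ m' s' x k → x * (s' + m' * suc s') + k * suc s' + x ≡ (x * suc m' + k) * suc s'
B-multiple = solve-∀

carry : ∀ s e k → (e + s) + k * s ≡ e + suc k * s
carry = solve-∀

module Semigroup (m' s' : ℕ) where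
  s m A B : ℕ
  s = suc s'
  m = suc m'
  A = m * s + 1
  B = m * s ∸ 1

  residue-form : ∀ n → n ≡ n % s + (n / s) * s
  residue-form n = m≡m%n+[m/n]*n n s

  division-unique : ∀ r k r' k' → r < s → r' < s → r + k * s ≡ r' + k' * s → r ≡ r' × k ≡ k'
  division-unique r k r' k' r<s r'<s eq = r≡r' , *-cancelʳ-≡ k k' s (+-cancelˡ-≡ r _ _ eq')
    where
    open ≡-Reasoning
    r≡r' : r ≡ r'
    r≡r' = begin
      r                ≡⟨ sym (m<n⇒m%n≡m r<s) ⟩
      r % s            ≡⟨ sym ([m+kn]%n≡m%n r k s) ⟩
      (r + k * s) % s  ≡⟨ cong (_% s) eq ⟩
      (r' + k' * s) % s ≡⟨ [m+kn]%n≡m%n r' k' s ⟩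
      r' % s           ≡⟨ m<n⇒m%n≡m r'<s ⟩
      r'               ∎
    eq' : r + k * s ≡ r + k' * s
    eq' = trans eq (cong (_+ k' * s) (sym r≡r'))

  data Generated : ℕ → Set where
    zero : Generated 0
    +s   : ∀ {n} → Generated n → Generated (n + s)
    +A   : ∀ {n} → Generated n → Generated (n + A)
    +B   : ∀ {n} → Generated n → Generated (n + B)

  generated-+ : ∀ {a b} → Generated a → Generated b → Generated (a + b)
  generated-+ {a} ga zero = subst Generated (sym (+-identityʳ a)) ga
  generated-+ {a} ga (+s {n} gn) = subst Generated (+-assoc a n s) (+s (generated-+ ga gn))
  generated-+ {a} ga (+A {n} gn) = subst Generated (+-assoc a n A) (+A (generated-+ ga gn))
  generated-+ {a} ga (+B {n} gn) = subst Generated (+-assoc a n B) (+B (generated-+ ga gn))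

  generated-multiple : ∀ g → (∀ {n} → Generated n → Generated (n + g)) → ∀ k → Generated (k * g)
  generated-multiple g step zero = zero
  generated-multiple g step (suc k) = subst Generated (+-comm (k * g) g) (step (generated-multiple g step k))

  -- The number of gaps in the residue class r (0 < r < s): they are
  -- r, r + s, …, r + (gapCount r - 1)·s.
  gapCount : ℕ → ℕ
  gapCount r with 2 * r <? s
  ... | yes _ = r * m
  ... | no _ = (s ∸ r) * m ∸ 1

  gapCount-low : ∀ r → 2 * r < s → gapCount r ≡ r * m
  gapCount-low r 2r<s with 2 * r <? s
  ... | yes _ = refl
  ... | no 2r≮s = ⊥-elim (2r≮s 2r<s)

  gapCount-high : ∀ r → ¬ 2 * r < s → gapCount r ≡ (s ∸ r) * m ∸ 1
  gapCount-high r 2r≮s with 2 * r <? s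
  ... | yes 2r<s = ⊥-elim (2r≮s 2r<s)
  ... | no _ = refl

  gapCount-≤-low : ∀ r → r < s → gapCount r ≤ r * m
  gapCount-≤-low r r<s with 2 * r <? s
  ... | yes _ = ≤-refl
  ... | no 2r≮s = ≤-trans (m∸n≤m _ 1) (*-monoˡ-≤ m s∸r≤r)
    where
    s∸r≤r : s ∸ r ≤ r
    s∸r≤r = ≤-trans (∸-monoˡ-≤ r (≮⇒≥ 2r≮s))
              (≤-reflexive (trans (cong (λ z → r + z ∸ r) (+-identityʳ r)) (m+n∸m≡n r r)))

  gapCount-≤-high : ∀ r → r < s → gapCount r ≤ (s ∸ r) * m ∸ 1
  gapCount-≤-high r r<s with 2 * r <? s
  ... | no _ = ≤-refl
  ... | yes 2r<s = ≤-trans (≤-reflexive (sym (m+n∸m≡n 1 (r * m))))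
                     (∸-monoˡ-≤ 1 (≤-trans (+-monoˡ-≤ (r * m) (s≤s (z≤n {m'})))
                        (*-monoˡ-≤ m r<s∸r)))
    where
    double-suc : ∀ r → suc (2 * r) ≡ r + suc r
    double-suc = solve-∀
    r<s∸r : suc r ≤ s ∸ r
    r<s∸r = ≤-trans (≤-reflexive (sym (m+n∸m≡n r (suc r))))
              (∸-monoˡ-≤ r (subst (_≤ s) (double-suc r) 2r<s))

  gapCount-≤ : ∀ r → r < s → gapCount r ≤ m * s
  gapCount-≤ r r<s = ≤-trans (gapCount-≤-low r r<s) (≤-trans (*-monoˡ-≤ m (<⇒≤ r<s)) (≤-reflexive (*-comm s m)))

  IsGap : ℕ → Set
  IsGap n = n / s < gapCount (n % s)

  gap-residue-positive : ∀ {n} → IsGap n → 0 < n % s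
  gap-residue-positive {n} gap with n % s
  ... | zero = ⊥-elim (<⇒≱ gap (≤-trans (≤-reflexive (gapCount-low 0 (s≤s z≤n))) z≤n))
  ... | suc _ = s≤s z≤n

  -- Since A ≡ 1, B ≡ -1 (mod s) and A + B = 2ms, every element of the
  -- semigroup is x·A + k·s or x·B + k·s.
  NormalForm : ℕ → Set
  NormalForm n = Σ ℕ λ x → Σ ℕ λ k → (n ≡ x * A + k * s) ⊎ (n ≡ x * B + k * s)

  normal-form : ∀ {n} → Generated n → NormalForm n
  normal-form zero = 0 , 0 , inj₁ refl
  normal-form (+s g) with normal-form g
  ... | x , k , inj₁ e = x , suc k , inj₁ (trans (cong (_+ s) e) (add-s _ k s))
  ... | x , k , inj₂ e = x , suc k , inj₂ (trans (cong (_+ s) e) (add-s _ k s))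
  normal-form (+A g) with normal-form g
  ... | x , k , inj₁ e = suc x , k , inj₁ (trans (cong (_+ A) e) (add-generator A x k s))
  ... | zero , k , inj₂ e = 1 , k , inj₁ (trans (cong (_+ A) e) (add-generator A 0 k s))
  ... | suc x , k , inj₂ e = x , k + 2 * m , inj₂ (trans (cong (_+ A) e) (A-cancels-B m' s' x k))
  normal-form (+B g) with normal-form g
  ... | x , k , inj₂ e = suc x , k , inj₂ (trans (cong (_+ B) e) (add-generator B x k s))
  ... | zero , k , inj₁ e = 1 , k , inj₂ (trans (cong (_+ B) e) (add-generator B 0 k s))
  ... | suc x , k , inj₁ e = x , k + 2 * m , inj₁ (trans (cong (_+ B) e) (B-cancels-A m' s' x k))

  -- Gaps are not of the form x·A + k·s: such a number r + q·s has
  -- r ≡ x and q ≥ x·m ≥ r·m ≥ gapCount r.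
  gap-not-A-form : ∀ n x k → IsGap n → n ≢ x * A + k * s
  gap-not-A-form n x k gap e = <⇒≱ gap (≤-trans (gapCount-≤-low r (m%n<n n s)) (≤-trans rm≤xm xm≤q))
    where
    r = n % s
    q = n / s
    ρ = x % s
    σ = x / s
    split-eq : r + q * s ≡ ρ + (σ + x * m + k) * s
    split-eq = begin
      r + q * s               ≡⟨ sym (residue-form n) ⟩
      n                       ≡⟨ e ⟩
      x * A + k * s           ≡⟨ A-form m' s' x k ⟩
      x + (x * m + k) * s     ≡⟨ cong (_+ (x * m + k) * s) (residue-form x) ⟩
      ρ + σ * s + (x * m + k) * s ≡⟨ merge-multiples s (x * m) k ρ σ ⟩
      ρ + (σ + x * m + k) * s ∎
      where open ≡-Reasoning
    unique = division-unique r q ρ (σ + x * m + k) (m%n<n n s) (m%n<n x s) split-eq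
    rm≤xm : r * m ≤ x * m
    rm≤xm = *-monoˡ-≤ m (subst (_≤ x) (sym (proj₁ unique)) (subst (ρ ≤_) (sym (residue-form x)) (m≤m+n ρ _)))
    xm≤q : x * m ≤ q
    xm≤q = subst (x * m ≤_) (sym (proj₂ unique)) (≤-trans (m≤n+m (x * m) σ) (m≤m+n _ k))

  residues-sum : ∀ n x k → n ≡ x * B + k * s →
                 (n % s + x % s) + (n / s + x / s) * s ≡ 0 + (x * m + k) * s
  residues-sum n x k e = begin
    (n % s + x % s) + (n / s + x / s) * s     ≡⟨ sym (interleave s (n % s) (n / s) (x % s) (x / s)) ⟩
    (n % s + n / s * s) + (x % s + x / s * s) ≡⟨ cong₂ _+_ (sym (residue-form n)) (sym (residue-form x)) ⟩
    n + x                                     ≡⟨ cong (_+ x) e ⟩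
    x * B + k * s + x                         ≡⟨ B-multiple m' s' x k ⟩
    (x * m + k) * s                           ∎
    where open ≡-Reasoning

  -- Gaps are not of the form x·B + k·s: then r + (x mod s) must be s, and
  -- q + 1 ≥ x·m ≥ (s - r)·m forces q ≥ gapCount r.
  gap-not-B-form : ∀ n x k → IsGap n → n ≢ x * B + k * s
  gap-not-B-form n x k gap e with (n % s) + (x % s) <? s
  ... | yes r+ρ<s = <⇒≱ (gap-residue-positive {n} gap) (≤-trans (m≤m+n r ρ) (≤-reflexive (proj₁ unique)))
    where
    r = n % s
    ρ = x % s
    unique = division-unique (r + ρ) (n / s + x / s) 0 (x * m + k) r+ρ<s (s≤s z≤n) (residues-sum n x k e)
  ... | no r+ρ≮s = <⇒≱ gap (≤-trans (gapCount-≤-high r (m%n<n n s)) s∸r·m∸1≤q)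
    where
    r = n % s
    q = n / s
    ρ = x % s
    σ = x / s
    s≤r+ρ = ≮⇒≥ r+ρ≮s
    e' = (r + ρ) ∸ s
    e'<s : e' < s
    e'<s = +-cancelʳ-< s e' s (subst (_< s + s) (sym (m∸n+n≡m s≤r+ρ)) (+-mono-< (m%n<n n s) (m%n<n x s)))
    unique = division-unique e' (suc (q + σ)) 0 (x * m + k) e'<s (s≤s z≤n)
      (trans (sym (carry s e' (q + σ)))
        (trans (cong (λ z → z + (q + σ) * s) (m∸n+n≡m s≤r+ρ)) (residues-sum n x k e)))
    r+ρ≡s : r + ρ ≡ s
    r+ρ≡s = trans (sym (m∸n+n≡m s≤r+ρ)) (cong (_+ s) (proj₁ unique))
    ρ≡s∸r : ρ ≡ s ∸ r
    ρ≡s∸r = trans (sym (m+n∸m≡n r ρ)) (cong (_∸ r) r+ρ≡s)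
    ρm+σ≤q+1+σ : ρ * m + σ ≤ suc q + σ
    ρm+σ≤q+1+σ = begin
      ρ * m + σ               ≤⟨ +-monoʳ-≤ (ρ * m) (m≤m*n σ (s * m)) ⟩
      ρ * m + σ * (s * m)     ≡⟨ sym (distribute m s ρ σ) ⟩
      (ρ + σ * s) * m         ≡⟨ cong (_* m) (sym (residue-form x)) ⟩
      x * m                   ≤⟨ m≤m+n (x * m) k ⟩
      x * m + k               ≡⟨ sym (proj₂ unique) ⟩
      suc (q + σ)             ∎
      where open ≤-Reasoning
    s∸r·m∸1≤q : (s ∸ r) * m ∸ 1 ≤ q
    s∸r·m∸1≤q = subst (λ z → z * m ∸ 1 ≤ q) ρ≡s∸r (∸-monoˡ-≤ 1 (+-cancelʳ-≤ σ _ _ ρm+σ≤q+1+σ))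

  gap⇒not-generated : ∀ n → IsGap n → ¬ Generated n
  gap⇒not-generated n gap g with normal-form g
  ... | x , k , inj₁ e = gap-not-A-form n x k gap e
  ... | x , k , inj₂ e = gap-not-B-form n x k gap e

  -- Conversely, r + k·s is generated once k ≥ r·m (use r copies of A) or,
  -- for r < s, once k ≥ (s - r)·m - 1 (use s - r copies of B).
  generated-via-A : ∀ r k → r * m ≤ k → Generated (r + k * s)
  generated-via-A r k rm≤k =
    subst Generated eq (generated-+ (generated-multiple A +A r) (generated-multiple s +s (k ∸ r * m)))
    where
    eq : r * A + (k ∸ r * m) * s ≡ r + k * s
    eq = trans (A-form m' s' r (k ∸ r * m)) (cong (λ z → r + z * s) (m+[n∸m]≡n rm≤k))

  generated-via-B : ∀ r k → r < s → (s ∸ r) * m ∸ 1 ≤ k → Generated (r + k * s)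
  generated-via-B r k (s≤s r≤s') le =
    subst Generated eq (generated-+ (generated-multiple B +B (suc v)) (generated-multiple s +s (k ∸ w)))
    where
    v = s' ∸ r
    w = m' + v * m
    w≤k : w ≤ k
    w≤k = subst (λ z → z * m ∸ 1 ≤ k) (+-∸-assoc 1 r≤s') le
    eq : suc v * B + (k ∸ w) * s ≡ r + k * s
    eq = trans (subst (λ S → suc v * (S + m' * suc S) + (k ∸ w) * suc S ≡ r + (w + (k ∸ w)) * suc S)
                      (m+[n∸m]≡n r≤s') (B-form m' v r (k ∸ w)))
               (cong (λ z → r + z * s) (m+[n∸m]≡n w≤k))

  not-gap⇒generated : ∀ n → ¬ IsGap n → Generated n
  not-gap⇒generated n not-gap = subst Generated (sym (residue-form n)) (by-class (2 * r <? s))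
    where
    r = n % s
    q = n / s
    count≤q = ≮⇒≥ not-gap
    by-class : Dec (2 * r < s) → Generated (r + q * s)
    by-class (yes low) = generated-via-A r q (subst (_≤ q) (gapCount-low r low) count≤q)
    by-class (no high) = generated-via-B r q (m%n<n n s) (subst (_≤ q) (gapCount-high r high) count≤q)

  isGap? : ∀ n → Dec (IsGap n)
  isGap? n = n / s <? gapCount (n % s)

  gap-positive : ∀ {b} → IsGap b → 0 < b
  gap-positive {b} gap = subst (0 <_) (sym (residue-form b))
                           (≤-trans (gap-residue-positive {b} gap) (m≤m+n _ _))

  gapsBelow : ℕ → List ℕ
  gapsBelow zero = []
  gapsBelow (suc n) with isGap? n
  ... | yes _ = n ∷ gapsBelow n
  ... | no _ = gapsBelow n

  gapsBelow-∈⁻ : ∀ n {b} → b ∈ gapsBelow n → b < n × IsGap b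
  gapsBelow-∈⁻ (suc n) {b} b∈ with isGap? n | b∈
  ... | yes gap | here refl = ≤-refl , gap
  ... | yes _ | there b∈' = let (b<n , gap) = gapsBelow-∈⁻ n b∈' in m≤n⇒m≤1+n b<n , gap
  ... | no _ | b∈' = let (b<n , gap) = gapsBelow-∈⁻ n b∈' in m≤n⇒m≤1+n b<n , gap

  gapsBelow-∈⁺ : ∀ n {b} → b < n → IsGap b → b ∈ gapsBelow n
  gapsBelow-∈⁺ (suc n) {b} (s≤s b≤n) gap with m≤n⇒m<n∨m≡n b≤n | isGap? n
  ... | inj₂ refl | yes _ = here refl
  ... | inj₂ refl | no not-gap = ⊥-elim (not-gap gap)
  ... | inj₁ b<n | yes _ = there (gapsBelow-∈⁺ n b<n gap)
  ... | inj₁ b<n | no _ = gapsBelow-∈⁺ n b<n gap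

  gapsBelow-strict : ∀ n → StrictlyDecreasing (gapsBelow n)
  gapsBelow-strict zero = []
  gapsBelow-strict (suc n) with isGap? n
  ... | no _ = gapsBelow-strict n
  ... | yes _ = cons (gapsBelow n) (gapsBelow-strict n) (All.tabulate (λ b∈ → proj₁ (gapsBelow-∈⁻ n b∈)))
    where
    cons : ∀ l → StrictlyDecreasing l → All (_< n) l → StrictlyDecreasing (n ∷ l)
    cons [] _ _ = [-]
    cons (y ∷ l) sd (y<n ∷ _) = y<n ∷ sd

  -- All gaps lie below N = ms², so gaps lists every gap.
  N : ℕ
  N = m * s * s

  gaps : List ℕ
  gaps = gapsBelow N

  gaps-strict : StrictlyDecreasing gaps
  gaps-strict = gapsBelow-strict N

  gaps-positive : All (0 <_) gaps
  gaps-positive = All.tabulate (λ b∈ → gap-positive (proj₂ (gapsBelow-∈⁻ N b∈)))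

  ∈gaps⇒not-generated : ∀ {n} → n ∈ gaps → ¬ Generated n
  ∈gaps⇒not-generated {n} n∈ = gap⇒not-generated n (proj₂ (gapsBelow-∈⁻ N n∈))

  not-generated⇒∈gaps : ∀ n → ¬ Generated n → n ∈ gaps
  not-generated⇒∈gaps n not-gen with isGap? n
  ... | no not-gap = ⊥-elim (not-gen (not-gap⇒generated n not-gap))
  ... | yes gap = gapsBelow-∈⁺ N n<N gap
    where
    q<ms : n / s < m * s
    q<ms = <-≤-trans gap (gapCount-≤ (n % s) (m%n<n n s))
    n<N : n < N
    n<N = begin-strict
      n                   ≡⟨ residue-form n ⟩
      n % s + (n / s) * s <⟨ +-monoˡ-< _ (m%n<n n s) ⟩
      suc (n / s) * s     ≤⟨ *-monoˡ-≤ s q<ms ⟩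
      m * s * s           ∎
      where open ≤-Reasoning

  -- The complement of a semigroup closed under adding g is closed under removing g.
  gaps-closed : ∀ g → (∀ {n} → Generated n → Generated (n + g)) → Closed g gaps
  gaps-closed g step {b} b∈ g≤b =
    not-generated⇒∈gaps (b ∸ g) (λ gen → ∈gaps⇒not-generated b∈ (subst Generated (m∸n+n≡m g≤b) (step gen)))

  longestCore : Partition
  longestCore = mkPartition (fromBetaSet gaps)
    (fromBetaSet-decreasing gaps gaps-strict gaps-positive , fromBetaSet-positive gaps gaps-strict gaps-positive)

  longestCore-core : ∀ g → (∀ {n} → Generated n → Generated (n + g)) → IsCore g longestCore
  longestCore-core g step =
    closed⇒core (fromBetaSet gaps) (fromBetaSet-decreasing gaps gaps-strict gaps-positive)
      (subst (Closed g) (sym (betaSet-fromBetaSet gaps gaps-strict gaps-positive)) (gaps-closed g step))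

  longestCore-3core : Is3Core s B A longestCore
  longestCore-3core = longestCore-core s +s , longestCore-core B +B , longestCore-core A +A

  -- A list of positive numbers closed under removing s, A and B contains no
  -- element of the semigroup: remove generators down to 0.
  closed-avoids-generated : ∀ bs → All (0 <_) bs → Closed s bs → Closed B bs → Closed A bs →
                            ∀ {n} → Generated n → n ∉ bs
  closed-avoids-generated bs pos cs cb ca = avoid
    where
    remove : ∀ {g n} → Closed g bs → n + g ∈ bs → n ∈ bs
    remove {g} {n} cl n+g∈ = subst (_∈ bs) (m+n∸n≡m n g) (cl n+g∈ (m≤n+m g n))
    avoid : ∀ {n} → Generated n → n ∉ bs
    avoid zero 0∈ = <-irrefl refl (All.lookup pos 0∈)
    avoid (+s gen) n∈ = avoid gen (remove cs n∈)
    avoid (+A gen) n∈ = avoid gen (remove ca n∈)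
    avoid (+B gen) n∈ = avoid gen (remove cb n∈)

  core-betaSet-⊆-gaps : ∀ p → Is3Core s B A p → ∀ {b} → b ∈ betaSet (parts p) → b ∈ gaps
  core-betaSet-⊆-gaps (mkPartition xs (dec , pos)) (cs , cb , ca) {b} b∈ =
    not-generated⇒∈gaps b (λ gen → closed-avoids-generated (betaSet xs) (betaSet-positive xs pos)
      (core⇒closed xs dec cs) (core⇒closed xs dec cb) (core⇒closed xs dec ca) gen b∈)

  core-vs-gaps : ∀ p → Is3Core s B A p →
                 len p ≤ length gaps × (length gaps ≤ len p → betaSet (parts p) ≡ gaps)
  core-vs-gaps p core
    with strict-⊆ (betaSet (parts p)) gaps (betaSet-strict (parts p) (proj₁ (isPartition p))) gaps-strict
                  (core-betaSet-⊆-gaps p core)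
  ... | le , eq rewrite length-betaSet (parts p) = le , eq

  length-longestCore : len longestCore ≡ length gaps
  length-longestCore = length-fromBetaSet gaps

  longestCore-longest : IsLongest3Core s B A longestCore
  longestCore-longest = longestCore-3core ,
    λ q core → subst (len q ≤_) (sym length-longestCore) (proj₁ (core-vs-gaps q core))

  -- Every longest core is longestCore, so its weight is that of longestCore.
  longest-weight : ∀ p → IsLongest3Core s B A p → weight p ≡ weight longestCore
  longest-weight p (core , longest) = cong sum (begin
    parts p                          ≡⟨ sym (fromBetaSet-betaSet (parts p)) ⟩
    fromBetaSet (betaSet (parts p))  ≡⟨ cong fromBetaSet (proj₂ (core-vs-gaps p core) gaps≤p) ⟩
    fromBetaSet gaps                 ∎)
    where
    open ≡-Reasoning
    gaps≤p : length gaps ≤ len p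
    gaps≤p = subst (_≤ len p) length-longestCore (longest longestCore longestCore-3core)

  onGaps : (ℕ → ℕ) → ℕ → ℕ
  onGaps φ i with isGap? i
  ... | yes _ = φ i
  ... | no _ = 0

  sum-gapsBelow : ∀ φ n → sum (map φ (gapsBelow n)) ≡ sumBelow n (onGaps φ)
  sum-gapsBelow φ zero = refl
  sum-gapsBelow φ (suc n) with isGap? n
  ... | yes _ = trans (+-comm (φ n) _) (cong (_+ φ n) (sum-gapsBelow φ n))
  ... | no _ = trans (sum-gapsBelow φ n) (sym (+-identityʳ _))

  residue-class : ∀ r q → r < s → r ≡ (r + q * s) % s × q ≡ (r + q * s) / s
  residue-class r q r<s = division-unique r q _ _ r<s (m%n<n (r + q * s) s) (residue-form (r + q * s))

  class-sum : ∀ φ r → r < s → ∑[ q < m * s ] onGaps φ (r + q * s) ≡ ∑[ q < gapCount r ] φ (r + q * s)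
  class-sum φ r r<s = sum-truncate (m * s) (gapCount r) _ _ (gapCount-≤ r r<s) below beyond
    where
    in-class : ∀ q → (q < gapCount r) ≡ IsGap (r + q * s)
    in-class q = cong₂ (λ a b → b < gapCount a) (proj₁ (residue-class r q r<s)) (proj₂ (residue-class r q r<s))
    below : ∀ q → q < gapCount r → onGaps φ (r + q * s) ≡ φ (r + q * s)
    below q q< with isGap? (r + q * s)
    ... | yes _ = refl
    ... | no not-gap = ⊥-elim (not-gap (subst (λ P → P) (in-class q) q<))
    beyond : ∀ q → gapCount r ≤ q → q < m * s → onGaps φ (r + q * s) ≡ 0
    beyond q c≤q _ with isGap? (r + q * s)
    ... | no _ = refl
    ... | yes gap = ⊥-elim (<⇒≱ (subst (λ P → P) (sym (in-class q)) gap) c≤q)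

  gaps-sum : ∀ φ → sum (map φ gaps) ≡ ∑[ r < s ] ∑[ q < gapCount r ] φ (r + q * s)
  gaps-sum φ = begin
    sum (map φ gaps)                                 ≡⟨ sum-gapsBelow φ N ⟩
    sumBelow (m * s * s) (onGaps φ)                  ≡⟨ sum-blocks (m * s) s (onGaps φ) ⟩
    ∑[ q < m * s ] ∑[ r < s ] onGaps φ (r + q * s)  ≡⟨ sum-swap (m * s) s (λ q r → onGaps φ (r + q * s)) ⟩
    ∑[ r < s ] ∑[ q < m * s ] onGaps φ (r + q * s)  ≡⟨ sum-cong s (class-sum φ) ⟩
    ∑[ r < s ] ∑[ q < gapCount r ] φ (r + q * s)    ∎
    where open ≡-Reasoning

  classTotal : ℕ → ℕ
  classTotal r = ∑[ q < gapCount r ] (2 * (r + q * s) + 1)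

  gaps-length : length gaps ≡ ∑[ r < s ] gapCount r
  gaps-length = trans (sym (length-as-sum gaps))
                  (trans (gaps-sum (λ (_ : ℕ) → 1)) (sum-cong s (λ r _ → sum-ones (gapCount r))))

  longestCore-weight-by-class :
    weight longestCore * 2 + length gaps * length gaps ≡ ∑[ r < s ] classTotal r
  longestCore-weight-by-class =
    trans (sym (betaSet-sum-inverse gaps gaps-strict gaps-positive)) (trans (sym (sum-map-odd gaps)) (gaps-sum (λ b → 2 * b + 1)))

-- Evaluation of the longest core for s = 1 + u + h with h ∈ {u, u + 1}: the
-- residues 1, …, u are "low" (2r < s, gapCount r = r·m) and the residues
-- s - j, j = 1, …, h, are "high" (gapCount = j·m - 1).
module Evaluation (m' u h : ℕ) (u≤h : u ≤ h) (h≤1+u : h ≤ suc u) where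
  open Semigroup m' (u + h)

  split-residues : ∀ f → f 0 ≡ 0 →
                   sumBelow s f ≡ ∑[ i < u ] f (suc i) + ∑[ i < h ] f (suc (u + (h ∸ suc i)))
  split-residues f f0≡0 = begin
    sumBelow (1 + (u + h)) f                              ≡⟨ sum-split 1 (u + h) f ⟩
    (0 + f 0) + ∑[ i < u + h ] f (suc i)                  ≡⟨ cong (_+ ∑[ i < u + h ] f (suc i)) f0≡0 ⟩
    ∑[ i < u + h ] f (suc i)                              ≡⟨ sum-split u h (λ i → f (suc i)) ⟩
    ∑[ i < u ] f (suc i) + ∑[ j < h ] f (suc (u + j))     ≡⟨ cong (∑[ i < u ] f (suc i) +_) (sum-reverse h (λ j → f (suc (u + j)))) ⟩
    ∑[ i < u ] f (suc i) + ∑[ i < h ] f (suc (u + (h ∸ suc i))) ∎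
    where open ≡-Reasoning

  gapCount-lowClass : ∀ i → i < u → gapCount (suc i) ≡ suc i * m
  gapCount-lowClass i i<u =
    gapCount-low (suc i) (s≤s (+-mono-≤ i<u (subst (_≤ h) (sym (+-identityʳ (suc i))) (≤-trans i<u u≤h))))

  -- The high residue s - (i + 1).
  highResidue : ℕ → ℕ
  highResidue i = suc (u + (h ∸ suc i))

  highResidue-complement : ∀ i → i < h → s ≡ highResidue i + suc i
  highResidue-complement i i<h =
    cong suc (trans (cong (u +_) (sym (m∸n+n≡m i<h))) (sym (+-assoc u (h ∸ suc i) (suc i))))

  gapCount-highClass : ∀ i → i < h → gapCount (highResidue i) ≡ m' + i * m
  gapCount-highClass i i<h =
    trans (gapCount-high r (λ 2r<s → <⇒≱ 2r<s s≤2r)) (cong (λ z → z * m ∸ 1) s∸r≡1+i)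
    where
    r = highResidue i
    i≤u : i ≤ u
    i≤u = ≤-pred (≤-trans (m≤n+m (suc i) (h ∸ suc i)) (subst (_≤ suc u) (sym (m∸n+n≡m i<h)) h≤1+u))
    s≤2r : s ≤ 2 * r
    s≤2r = subst (_≤ 2 * r) (sym (highResidue-complement i i<h))
             (+-monoʳ-≤ r (subst (suc i ≤_) (sym (+-identityʳ r)) (s≤s (≤-trans i≤u (m≤m+n u _)))))
    s∸r≡1+i : s ∸ r ≡ suc i
    s∸r≡1+i = trans (cong (_∸ r) (highResidue-complement i i<h)) (m+n∸m≡n r (suc i))

  lowClass : ∀ i → i < u → classTotal (suc i) + (0 * (suc i * suc i) + s * m * suc i + 0)
                           ≡ (2 * m + s * m * m) * (suc i * suc i) + m * suc i + 0
  lowClass i i<u = begin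
    classTotal j + (0 * (j * j) + s * m * j + 0)
      ≡⟨ cong (λ c → ∑[ q < c ] (2 * (j + q * s) + 1) + (0 * (j * j) + s * m * j + 0)) (gapCount-lowClass i i<u) ⟩
    ∑[ q < j * m ] (2 * (j + q * s) + 1) + (0 * (j * j) + s * m * j + 0)
      ≡⟨ reorder (∑[ q < j * m ] (2 * (j + q * s) + 1)) s m j ⟩
    ∑[ q < j * m ] (2 * (j + q * s) + 1) + s * (j * m)  ≡⟨ sum-arithmetic j s (j * m) ⟩
    j * m * (2 * j + 1 + s * (j * m))                  ≡⟨ expand s m j ⟩
    (2 * m + s * m * m) * (j * j) + m * j + 0          ∎
    where
    open ≡-Reasoning
    j = suc i
    reorder : ∀ T s m j → T + (0 * (j * j) + s * m * j + 0) ≡ T + s * (j * m)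
    reorder = solve-∀
    expand : ∀ s m j → j * m * (2 * j + 1 + s * (j * m)) ≡ (2 * m + s * m * m) * (j * j) + m * j + 0
    expand = solve-∀

  highClass : ∀ i → i < h → classTotal (highResidue i) + (2 * m * (suc i * suc i) + s * m * suc i + 1)
                            ≡ s * m * m * (suc i * suc i) + (m + 2) * suc i + 0
  highClass i i<h = +-cancelʳ-≡ (s * c) _ _ (begin
    classTotal r + (2 * m * (j * j) + s * m * j + 1) + s * c
      ≡⟨ cong (λ k → ∑[ q < k ] (2 * (r + q * s) + 1) + (2 * m * (j * j) + s * m * j + 1) + s * c)
              (gapCount-highClass i i<h) ⟩
    T + (2 * m * (j * j) + s * m * j + 1) + s * c      ≡⟨ reorder T (2 * m * (j * j) + s * m * j + 1) (s * c) ⟩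
    (T + s * c) + (2 * m * (j * j) + s * m * j + 1)    ≡⟨ cong (_+ (2 * m * (j * j) + s * m * j + 1)) (sum-arithmetic r s c) ⟩
    c * (2 * r + 1 + s * c) + (2 * m * (j * j) + s * m * j + 1)
      ≡⟨ subst (λ S → c * (2 * r + 1 + S * c) + (2 * m * (j * j) + S * m * j + 1)
                      ≡ S * m * m * (j * j) + (m + 2) * j + 0 + S * c)
               (sym (highResidue-complement i i<h)) (expand r i m') ⟩
    s * m * m * (j * j) + (m + 2) * j + 0 + s * c      ∎)
    where
    open ≡-Reasoning
    j = suc i
    r = highResidue i
    c = m' + i * m
    T = ∑[ q < c ] (2 * (r + q * s) + 1)
    reorder : ∀ T Q X → T + Q + X ≡ (T + X) + Q
    reorder = solve-∀
    expand : ∀ r i m' → let m = suc m' ; j = suc i ; c = m' + i * suc m' in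
             c * (2 * r + 1 + (r + j) * c) + (2 * m * (j * j) + (r + j) * m * j + 1)
             ≡ (r + j) * m * m * (j * j) + (m + 2) * j + 0 + (r + j) * c
    expand = solve-∀

  gaps-count : 6 * length gaps + (sixSumQuadratic 0 0 0 u + sixSumQuadratic 0 0 1 h)
               ≡ sixSumQuadratic 0 m 0 u + sixSumQuadratic 0 m 0 h
  gaps-count = begin
    6 * length gaps + (QL + QH)                            ≡⟨ cong (λ G → 6 * G + (QL + QH)) count-split ⟩
    6 * (GL + GH) + (QL + QH)                              ≡⟨ regroup GL GH QL QH ⟩
    (6 * GL + QL) + (6 * GH + QH)                          ≡⟨ cong₂ _+_ low high ⟩
    sixSumQuadratic 0 m 0 u + sixSumQuadratic 0 m 0 h      ∎
    where
    open ≡-Reasoning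
    QL = sixSumQuadratic 0 0 0 u
    QH = sixSumQuadratic 0 0 1 h
    GL = ∑[ i < u ] gapCount (suc i)
    GH = ∑[ i < h ] gapCount (highResidue i)
    count-split : length gaps ≡ GL + GH
    count-split = trans gaps-length (split-residues gapCount (gapCount-low 0 (s≤s z≤n)))
    regroup : ∀ a b x y → 6 * (a + b) + (x + y) ≡ (6 * a + x) + (6 * b + y)
    regroup = solve-∀
    low-term : ∀ m j → j * m + (0 * (j * j) + 0 * j + 0) ≡ 0 * (j * j) + m * j + 0
    low-term = solve-∀
    high-term : ∀ m' i → m' + i * suc m' + (0 * (suc i * suc i) + 0 * suc i + 1) ≡ 0 * (suc i * suc i) + suc m' * suc i + 0
    high-term = solve-∀
    low : 6 * GL + QL ≡ sixSumQuadratic 0 m 0 u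
    low = sum-quadratic _ 0 0 0 0 m 0 u
            (λ i i<u → trans (cong (_+ _) (gapCount-lowClass i i<u)) (low-term m (suc i)))
    high : 6 * GH + QH ≡ sixSumQuadratic 0 m 0 h
    high = sum-quadratic _ 0 0 1 0 m 0 h
             (λ i i<h → trans (cong (_+ _) (gapCount-highClass i i<h)) (high-term m' i))

  gaps-total : 2 * (6 * weight longestCore) + 6 * (length gaps * length gaps)
                 + (sixSumQuadratic 0 (s * m) 0 u + sixSumQuadratic (2 * m) (s * m) 1 h)
               ≡ sixSumQuadratic (2 * m + s * m * m) m 0 u + sixSumQuadratic (s * m * m) (m + 2) 0 h
  gaps-total = begin
    2 * (6 * w) + 6 * (G * G) + (QL + QH)                 ≡⟨ regroup w G QL QH ⟩
    6 * (w * 2 + G * G) + (QL + QH)                       ≡⟨ cong (λ z → 6 * z + (QL + QH)) longestCore-weight-by-class ⟩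
    6 * ∑[ r < s ] classTotal r + (QL + QH)               ≡⟨ cong (λ z → 6 * z + (QL + QH)) total-split ⟩
    6 * (XL + XH) + (QL + QH)                             ≡⟨ regroup′ XL XH QL QH ⟩
    (6 * XL + QL) + (6 * XH + QH)                         ≡⟨ cong₂ _+_ low high ⟩
    sixSumQuadratic (2 * m + s * m * m) m 0 u + sixSumQuadratic (s * m * m) (m + 2) 0 h ∎
    where
    open ≡-Reasoning
    w = weight longestCore
    G = length gaps
    QL = sixSumQuadratic 0 (s * m) 0 u
    QH = sixSumQuadratic (2 * m) (s * m) 1 h
    XL = ∑[ i < u ] classTotal (suc i)
    XH = ∑[ i < h ] classTotal (highResidue i)
    total-split : ∑[ r < s ] classTotal r ≡ XL + XH
    total-split = split-residues classTotal
                    (cong (λ c → ∑[ q < c ] (2 * (0 + q * s) + 1)) (gapCount-low 0 (s≤s z≤n)))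
    regroup : ∀ w G x y → 2 * (6 * w) + 6 * (G * G) + (x + y) ≡ 6 * (w * 2 + G * G) + (x + y)
    regroup = solve-∀
    regroup′ : ∀ a b x y → 6 * (a + b) + (x + y) ≡ (6 * a + x) + (6 * b + y)
    regroup′ = solve-∀
    low : 6 * XL + QL ≡ sixSumQuadratic (2 * m + s * m * m) m 0 u
    low = sum-quadratic _ 0 (s * m) 0 (2 * m + s * m * m) m 0 u lowClass
    high : 6 * XH + QH ≡ sixSumQuadratic (s * m * m) (m + 2) 0 h
    high = sum-quadratic _ (2 * m) (s * m) 1 (s * m * m) (m + 2) 0 h highClass

  longest-length : ∀ G → 6 * G + (sixSumQuadratic 0 0 0 u + sixSumQuadratic 0 0 1 h)
                           ≡ sixSumQuadratic 0 m 0 u + sixSumQuadratic 0 m 0 h →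
                   length gaps ≡ G
  longest-length G count = *-cancelˡ-≡ _ _ 6 (+-cancelʳ-≡ _ _ _ (trans gaps-count (sym count)))

  longest-weight-closed : ∀ G F E → length gaps ≡ G →
    2 * F + (6 * (G * G) + (sixSumQuadratic 0 (s * m) 0 u + sixSumQuadratic (2 * m) (s * m) 1 h))
      ≡ sixSumQuadratic (2 * m + s * m * m) m 0 u + sixSumQuadratic (s * m * m) (m + 2) 0 h + 2 * E →
    ∀ p → IsLongest3Core s B A p → 6 * weight p + E ≡ F
  longest-weight-closed G F E refl total p longest =
    *-cancelˡ-≡ _ _ 2 (+-cancelʳ-≡ K _ _ (begin
      2 * (6 * weight p + E) + K      ≡⟨ cong (λ z → 2 * (6 * z + E) + K) (longest-weight p longest) ⟩
      2 * (6 * w + E) + K             ≡⟨ regroup w E (6 * (G * G)) QL ⟩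
      (2 * (6 * w) + 6 * (G * G) + QL) + 2 * E ≡⟨ cong (_+ 2 * E) gaps-total ⟩
      R + 2 * E                       ≡⟨ sym total ⟩
      2 * F + K                       ∎))
    where
    open ≡-Reasoning
    w = weight longestCore
    QL = sixSumQuadratic 0 (s * m) 0 u + sixSumQuadratic (2 * m) (s * m) 1 h
    K = 6 * (G * G) + QL
    R = sixSumQuadratic (2 * m + s * m * m) m 0 u + sixSumQuadratic (s * m * m) (m + 2) 0 h
    regroup : ∀ w E g q → 2 * (6 * w + E) + (g + q) ≡ (2 * (6 * w) + g + q) + 2 * E
    regroup = solve-∀

-- Polynomial identities evaluating the closed forms for s = 2t - 1 and
-- s = 2t - 2; here Q a b c n = 6·∑_{j=1}^{n} (a·j² + b·j + c).
odd-count : ∀ u m' →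
  let m = suc m'
      Q = λ a b c n → a * (n * suc n * suc (2 * n)) + 3 * b * (n * suc n) + 6 * c * n
  in 6 * (u * (u * m + m')) + (Q 0 0 0 u + Q 0 0 1 u) ≡ Q 0 m 0 u + Q 0 m 0 u
odd-count = solve-∀

odd-total : ∀ u m' →
  let m = suc m'
      s = suc (u + u)
      G = u * (u * m + m')
      Q = λ a b c n → a * (n * suc n * suc (2 * n)) + 3 * b * (n * suc n) + 6 * c * n
  in 2 * (m * m * suc u * u * (u * suc u + 1)) + (6 * (G * G) + (Q 0 (s * m) 0 u + Q (2 * m) (s * m) 1 u))
     ≡ Q (2 * m + s * m * m) m 0 u + Q (s * m * m) (m + 2) 0 u + 2 * 0
odd-total = solve-∀

even-count : ∀ u m' →
  let m = suc m'
      Q = λ a b c n → a * (n * suc n * suc (2 * n)) + 3 * b * (n * suc n) + 6 * c * n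
  in 6 * (suc u * (u * m + m')) + (Q 0 0 0 u + Q 0 0 1 (suc u)) ≡ Q 0 m 0 u + Q 0 m 0 (suc u)
even-count = solve-∀

even-total : ∀ u m' →
  let m = suc m'
      s = suc (u + suc u)
      G = suc u * (u * m + m')
      Q = λ a b c n → a * (n * suc n * suc (2 * n)) + 3 * b * (n * suc n) + 6 * c * n
  in 2 * (m * m * suc u * suc u * (u * suc (suc u) + 3))
       + (6 * (G * G) + (Q 0 (s * m) 0 u + Q (2 * m) (s * m) 1 (suc u)))
     ≡ Q (2 * m + s * m * m) m 0 u + Q (s * m * m) (m + 2) 0 (suc u) + 2 * (3 * m * suc u * suc u)
even-total = solve-∀

odd-weight : ∀ m' u s' → s' ≡ u + u → ∀ p →
  IsLongest3Core (suc s') (suc m' * suc s' ∸ 1) (suc m' * suc s' + 1) p →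
  6 * weight p ≡ suc m' * suc m' * suc u * (suc u ∸ 1) * (suc u * suc u ∸ suc u + 1)
odd-weight m' u .(u + u) refl p longest = begin
  6 * weight p                                      ≡⟨ sym (+-identityʳ _) ⟩
  6 * weight p + 0                                  ≡⟨ longest-weight-closed G _ 0 G-eq (odd-total u m') p longest ⟩
  m * m * t * u * (u * t + 1)                       ≡⟨ cong (λ z → m * m * t * u * (z + 1)) (sym (m+n∸m≡n t (u * t))) ⟩
  m * m * t * (t ∸ 1) * (t * t ∸ t + 1)             ∎
  where
  open ≡-Reasoning
  open Evaluation m' u u ≤-refl (n≤1+n u)
  m = suc m'
  t = suc u
  G = u * (u * m + m')
  G-eq = longest-length G (odd-count u m')

even-weight : ∀ m' u s' → s' ≡ u + suc u → ∀ p →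
  IsLongest3Core (suc s') (suc m' * suc s' ∸ 1) (suc m' * suc s' + 1) p →
  6 * weight p + 3 * suc m' * (suc (suc u) ∸ 1) * (suc (suc u) ∸ 1)
    ≡ suc m' * suc m' * (suc (suc u) ∸ 1) * (suc (suc u) ∸ 1) * (suc (suc u) * suc (suc u) ∸ 2 * suc (suc u) + 3)
even-weight m' u .(u + suc u) refl p longest = begin
  6 * weight p + 3 * m * suc u * suc u              ≡⟨ longest-weight-closed G _ _ G-eq (even-total u m') p longest ⟩
  m * m * suc u * suc u * (u * t + 3)               ≡⟨ cong (λ z → m * m * suc u * suc u * (z + 3)) (sym t²∸2t) ⟩
  m * m * suc u * suc u * (t * t ∸ 2 * t + 3)       ∎
  where
  open ≡-Reasoning
  open Evaluation m' u (suc u) (n≤1+n u) ≤-refl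
  m = suc m'
  t = suc (suc u)
  G = suc u * (u * m + m')
  G-eq = longest-length G (even-count u m')
  square : ∀ u → suc (suc u) * suc (suc u) ≡ 2 * suc (suc u) + u * suc (suc u)
  square = solve-∀
  t²∸2t : t * t ∸ 2 * t ≡ u * t
  t²∸2t = trans (cong (_∸ 2 * t) (square u)) (m+n∸m≡n (2 * t) (u * t))

odd-shape : ∀ s' u → suc s' ≡ 2 * suc u ∸ 1 → s' ≡ u + u
odd-shape s' u e = suc-injective (trans e (trans (cong (u +_) (+-identityʳ (suc u))) (+-suc u u)))

even-shape : ∀ s' u → suc s' ≡ 2 * suc (suc u) ∸ 2 → s' ≡ u + suc u
even-shape s' u e = suc-injective (trans e (trans (cong (u +_) (+-identityʳ (suc (suc u)))) (+-suc u (suc u))))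

theorem1p15 : ∀ (m s : ℕ) → 1 ≤ m → 1 ≤ s →
    (∃ λ p → IsLongest3Core s (m * s ∸ 1) (m * s + 1) p)
    × (∀ p → IsLongest3Core s (m * s ∸ 1) (m * s + 1) p →
        (∀ t → 1 ≤ t → s ≡ 2 * t ∸ 1 →
          6 * weight p ≡ m * m * t * (t ∸ 1) * (t * t ∸ t + 1))
        × (∀ t → 2 ≤ t → s ≡ 2 * t ∸ 2 →
          6 * weight p + 3 * m * (t ∸ 1) * (t ∸ 1)
            ≡ m * m * (t ∸ 1) * (t ∸ 1) * (t * t ∸ 2 * t + 3)))
theorem1p15 (suc m') (suc s') _ _ =
  (longestCore , longestCore-longest) ,
  λ p longest →
    (λ { (suc u) _ e → odd-weight m' u s' (odd-shape s' u e) p longest }) ,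
    (λ { (suc (suc u)) _ e → even-weight m' u s' (even-shape s' u e) p longest })
  where open Semigroup m' s'
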